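{- Let $(G,\mathcal C)$ be an edge-colored graph with conflict graph $H$ and color-intersection graph $\Gamma$. Let $c$ be an articulation vertex of $\Gamma$ and let $A_1,\dots,A_t$ be the connected components of $\Gamma-c$. Let $W_i=\{e\in E(G): c(e)\in V(A_i)\}$ and $E_c=\{e\in E(G): c(e)=c\}$. Then (1) $E_c$ is a clique in $H$, and (2) for $i\ne j$ there are no edges of $H$ between $W_i$ and $W_j$. Hence $E_c$ is a clique cutset of $H$ separating $W_1,\dots,W_t$.
   Context: An edge-colored graph $(G,\mathcal C)$: finite simple graph $G=(V,E)$ with a partition $\mathcal C$ of $E$ into color classes; $c(e)$ is the color of $e$. Conflict graph $H$: vertex set $E$, $e\ne f$ adjacent iff they share an endpoint or have the same color. Color-intersection graph $\Gamma$: vertex set $\mathcal C$, two distinct colors adjacent iff some edge of one color shares an endpoint with some edge of the other. -}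

module Defs where

open import Data.Nat using (ℕ)
open import Data.Fin using (Fin)
open import Data.Product using (Σ; ∃; ∃-syntax; _×_; _,_)
open import Data.Sum using (_⊎_)
open import Relation.Nullary using (¬_)
open import Relation.Binary.PropositionalEquality using (_≡_; _≢_)
open import Relation.Binary.Construct.Closure.ReflexiveTransitive using (Star)

-- A finite simple graph G with vertex set Fin n and edge set Fin m
-- (edge e has endpoints end₁ e ≠ end₂ e; distinct edges have distinct
-- endpoint sets), together with a partition of E into k nonempty colour
-- classes, given by a surjective colouring map  colour : Fin m → Fin k.
record EdgeColoredGraph : Set where
  field
    n m k   : ℕ
    end₁    : Fin m → Fin n
    end₂    : Fin m → Fin n
    loopless : ∀ e → end₁ e ≢ end₂ e
    simple  : ∀ e f → ((end₁ e ≡ end₁ f × end₂ e ≡ end₂ f) ⊎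
                       (end₁ e ≡ end₂ f × end₂ e ≡ end₁ f)) → e ≡ f
    colour  : Fin m → Fin k
    colour-surjective : ∀ a → ∃[ e ] colour e ≡ a

  Vertex = Fin n
  Edge   = Fin m
  Colour = Fin k

  Incident : Vertex → Edge → Set
  Incident x e = x ≡ end₁ e ⊎ x ≡ end₂ e

  ShareEndpoint : Edge → Edge → Set
  ShareEndpoint e f = ∃[ x ] (Incident x e × Incident x f)

  HAdj : Edge → Edge → Set
  HAdj e f = e ≢ f × (ShareEndpoint e f ⊎ colour e ≡ colour f)

  ΓAdj : Colour → Colour → Set
  ΓAdj a b = a ≢ b × ∃[ e ] ∃[ f ] (colour e ≡ a × colour f ≡ b × ShareEndpoint e f)

Restrict : {V : Set} → (V → Set) → (V → V → Set) → V → V → Set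
Restrict P R x y = P x × P y × R x y

ConnectedAvoiding : {V : Set} → (V → V → Set) → V → V → V → Set
ConnectedAvoiding R v x y = x ≢ v × y ≢ v × Star (Restrict (λ z → z ≢ v) R) x y

-- c is an articulation (cut) vertex of Γ: some two vertices other than c
-- lie in the same component of Γ but in different components of Γ − c
-- (equivalently, deleting c increases the number of components).
IsArticulation : (G : EdgeColoredGraph) → EdgeColoredGraph.Colour G → Set
IsArticulation G c =
  ∃[ a ] ∃[ b ] (a ≢ c × b ≢ c × Star ΓAdj a b × ¬ ConnectedAvoiding ΓAdj c a b)
  where open EdgeColoredGraph G

IsClique : {V : Set} → (V → V → Set) → (V → Set) → Set
IsClique {V} R S = ∀ x y → S x → S y → x ≢ y → R x y

{-# OPTIONS --safe #-}
module Submission where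

-- The colouring maps every edge of H − E_c either to a single colour or to an
-- edge of Γ − c (edges sharing an endpoint have equal or Γ-adjacent colours),
-- so walks in H − E_c become walks in Γ − c, and the W_i stay apart.

open import Defs
open import Data.Product using (∃-syntax; _×_; _,_)
open import Data.Sum using (_⊎_; inj₁; inj₂)
open import Data.Fin using (_≟_)
open import Relation.Nullary using (¬_; yes; no)
open import Relation.Binary.Core using (_=[_]⇒_)
open import Relation.Binary.PropositionalEquality using (_≡_; _≢_; refl; sym; trans)
open import Relation.Binary.Construct.Closure.ReflexiveTransitive
  using (Star; ε; _◅_; kleisliStar)

module _ (G : EdgeColoredGraph) where
  open EdgeColoredGraph G

  colourClass-isClique : ∀ a → IsClique HAdj (λ e → colour e ≡ a)
  colourClass-isClique a e f ea fa e≢f = e≢f , inj₂ (trans ea (sym fa))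

  ShareEndpoint⇒colours-adjacent : ∀ {e f} → ShareEndpoint e f →
    colour e ≡ colour f ⊎ ΓAdj (colour e) (colour f)
  ShareEndpoint⇒colours-adjacent {e} {f} shared with colour e ≟ colour f
  ... | yes same = inj₁ same
  ... | no differ = inj₂ (differ , e , f , refl , refl , shared)

  module _ (c : Colour) where

    H−E_c : Edge → Edge → Set
    H−E_c = Restrict (λ e → colour e ≢ c) HAdj

    Γ−c : Colour → Colour → Set
    Γ−c = Restrict (λ a → a ≢ c) ΓAdj

    colour-maps-H−E_c-edges : H−E_c =[ colour ]⇒ Star Γ−c
    colour-maps-H−E_c-edges (_ , _ , _ , inj₂ same) rewrite same = ε
    colour-maps-H−E_c-edges (ec , fc , _ , inj₁ shared)
      with ShareEndpoint⇒colours-adjacent shared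
    ... | inj₁ same rewrite same = ε
    ... | inj₂ adjacent = (ec , fc , adjacent) ◅ ε

    colour-maps-H−E_c-walks : Star H−E_c =[ colour ]⇒ Star Γ−c
    colour-maps-H−E_c-walks = kleisliStar colour colour-maps-H−E_c-edges

    H−E_c-walk⇒ConnectedAvoiding : ∀ {e f} → colour e ≢ c → colour f ≢ c →
      Star H−E_c e f → ConnectedAvoiding ΓAdj c (colour e) (colour f)
    H−E_c-walk⇒ConnectedAvoiding ec fc walk = ec , fc , colour-maps-H−E_c-walks walk

    IsArticulation⇒separated-edges : IsArticulation G c →
      ∃[ e ] ∃[ f ] (colour e ≢ c × colour f ≢ c ×
        ¬ ConnectedAvoiding ΓAdj c (colour e) (colour f))
    IsArticulation⇒separated-edges (a , b , ac , bc , _ , separated)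
      with colour-surjective a | colour-surjective b
    ... | e , refl | f , refl = e , f , ac , bc , separated

mainTheorem5 : (G : EdgeColoredGraph) → (c : EdgeColoredGraph.Colour G) →
    IsArticulation G c →
    let open EdgeColoredGraph G in
    -- (1) E_c is a clique in H
    IsClique HAdj (λ e → colour e ≡ c)
    -- (2) edges of W_i, W_j (colours in different components of Γ − c) are non-adjacent in H
    × (∀ e f → colour e ≢ c → colour f ≢ c →
         ¬ ConnectedAvoiding ΓAdj c (colour e) (colour f) → ¬ HAdj e f)
    -- hence E_c is a clique cutset of H separating the W_i:
    -- no walk in H − E_c joins W_i and W_j for i ≠ j
    × (∀ e f → colour e ≢ c → colour f ≢ c →
         ¬ ConnectedAvoiding ΓAdj c (colour e) (colour f) →
         ¬ Star (Restrict (λ g → colour g ≢ c) HAdj) e f)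
    -- and H − E_c is indeed disconnected (at least two nonempty W_i)
    × (∃[ e ] ∃[ f ] (colour e ≢ c × colour f ≢ c ×
         ¬ ConnectedAvoiding ΓAdj c (colour e) (colour f)))
mainTheorem5 G c articulation =
    colourClass-isClique G c
  , (λ e f ec fc separated adjacent →
       separated (H−E_c-walk⇒ConnectedAvoiding G c ec fc ((ec , fc , adjacent) ◅ ε)))
  , (λ e f ec fc separated walk →
       separated (H−E_c-walk⇒ConnectedAvoiding G c ec fc walk))
  , IsArticulation⇒separated-edges G c articulation
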